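{- Let $p\geq 5$ be a prime, $n$ a positive integer, and let $A\subseteq\mathbb{F}_p^{n}$ be a set not containing $p$ distinct elements $x_1,\dots,x_p\in A$ with $x_1+\dots+x_p=0$. Let $A'\subseteq A$ and let $\lambda=(\lambda_1,\dots,\lambda_k)$ be a multiplicity pattern such that every cycle in $A'\times\dots\times A'$ has multiplicity pattern of length at most $k$. Let $\mathcal{M}$ be a collection of pairwise disjoint cycles in $A'\times\dots\times A'$, each with multiplicity pattern $\lambda$, and each ordered so that, dividing $\{1,\dots,p\}$ into consecutive blocks of sizes $\lambda_1,\lambda_2,\dots,\lambda_k$ (the first block being $\{1,\dots,\lambda_1\}$, etc.), for each $(x_1,\dots,x_p)\in\mathcal{M}$ we have $x_i=x_j$ if and only if $i$ and $j$ lie in the same block. For $i=1,\dots,p$ let $X_i=\{x_i\mid (x_1,\dots,x_p)\in\mathcal{M}\}$. Then every cycle $(x_1,\dots,x_p)\in X_1\times\dots\times X_p$ satisfies $x_1=x_2$.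
   Context: A cycle is a $p$-tuple $(x_1,\dots,x_p)\in (\mathbb{F}_p^{n})^p$ with $x_1+\dots+x_p=0$. Two cycles are disjoint if the sets of elements occurring in them are disjoint. The multiplicity pattern of a cycle $(x_1,\dots,x_p)$ is $(\lambda_1,\dots,\lambda_k)$, where $k$ is the number of distinct elements among $x_1,\dots,x_p$ and $\lambda_1\geq\dots\geq\lambda_k>0$ are the multiplicities with which these elements occur; $k$ is called the length of the pattern. -}

module Defs where

open import Data.Nat using (ℕ; zero; suc; _+_; _≤_; _<_; _≥_)
open import Data.Nat.Divisibility using (_∣_)
open import Data.Fin using (Fin; toℕ)
import Data.Fin.Properties as FinP
open import Data.Vec using (Vec; lookup; tabulate; toList)
import Data.Vec as Vec
import Data.Vec.Properties as VecP
open import Data.List using (List; length; take; deduplicate)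
open import Data.Nat.ListAction using () renaming (sum to listSum)
open import Data.Product using (Σ; ∃; ∃-syntax; _×_; _,_)
open import Relation.Binary.PropositionalEquality using (_≡_; _≢_)
open import Function.Definitions using (Injective)
open import Function.Bundles using (_⇔_)

Vecp : ℕ → ℕ → Set
Vecp p n = Vec (Fin p) n

Tuple : ℕ → ℕ → Set
Tuple p n = Fin p → Vecp p n

SubsetF : ℕ → ℕ → Set₁
SubsetF p n = Vecp p n → Set

-- x₁ + ... + x_p = 0 in 𝔽_p^n : for each coordinate j, the integer sum of
-- the j-th coordinates (as residues 0..p-1) is divisible by p.
IsCycle : ∀ {p n} → Tuple p n → Set
IsCycle {p} {n} x = (j : Fin n) → p ∣ Vec.sum (tabulate (λ i → toℕ (lookup (x i) j)))

-- Length of the multiplicity pattern = number of distinct entries.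
patternLength : ∀ {p n} → Tuple p n → ℕ
patternLength {p} x = length (deduplicate (VecP.≡-dec FinP._≟_) (toList (tabulate x)))

IsPattern : (p k : ℕ) → Vec ℕ k → Set
IsPattern p k lam =
  ((b : Fin k) → 1 ≤ lookup lam b) ×
  ((b c : Fin k) → toℕ b ≤ toℕ c → lookup lam c ≤ lookup lam b) ×
  Vec.sum lam ≡ p

-- Index i (0-based) lies in block b, i.e. λ₁+…+λ_b ≤ i < λ₁+…+λ_{b+1}.
InBlock : ∀ {k} → Vec ℕ k → Fin k → ℕ → Set
InBlock lam b i =
  listSum (take (toℕ b) (toList lam)) ≤ i ×
  i < listSum (take (toℕ b) (toList lam)) + lookup lam b

SameBlock : ∀ {k} → Vec ℕ k → ℕ → ℕ → Set
SameBlock {k} lam i j = Σ (Fin k) λ b → InBlock lam b i × InBlock lam b j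

-- Disjointness makes the entries of x respect the block partition: if x a = x a', the
-- cycles of M supplying x a and x a' share an element, hence coincide, so a and a' lie
-- in the same block of λ. If λ₁ = 1 every block is a singleton, so every cycle of M has
-- p distinct entries in A, which is impossible. If λ₁ ≥ 2 and x₁ ≠ x₂, then x₂ together
-- with the entries of x at the k block starts are k + 1 distinct elements of a cycle in
-- A′, contradicting the bound on pattern lengths.
module Submission where

open import Defs
open import Data.Nat using (ℕ; zero; suc; _+_; _≤_; _<_; z≤n; s≤s⁻¹)
open import Data.Nat.Primality using (Prime)
open import Data.Nat.Properties
open import Data.Fin using (Fin; zero; suc; toℕ; fromℕ<)
import Data.Fin.Properties as FinP
open import Data.Vec using (Vec; []; _∷_; lookup; toList)
import Data.Vec as Vec
import Data.Vec.Properties as VecP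
open import Data.Vec.Membership.Propositional.Properties using (∈-tabulate⁺; ∈-toList⁺)
open import Data.List using (List; length; take)
open import Data.Nat.ListAction using () renaming (sum to listSum)
open import Data.List.Membership.Propositional using (_∈_)
open import Data.List.Membership.Propositional.Properties using (∈-deduplicate⁺)
open import Data.List.Relation.Unary.Any using (index)
open import Data.List.Relation.Unary.Any.Properties using (lookup-index)
open import Data.Product using (Σ; _×_; _,_; proj₁; proj₂)
open import Data.Empty using (⊥-elim)
open import Function using (_∘_)
open import Function.Bundles using (_⇔_; Equivalence)
open import Function.Definitions using (Injective)
open import Relation.Binary.Definitions using (tri<; tri≈; tri>)
open import Relation.Binary.PropositionalEquality using (_≡_; _≢_; refl; sym; trans; cong; subst)
open import Relation.Nullary using (¬_; yes; no; contradiction)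

blockStart : ∀ {k} → Vec ℕ k → Fin k → ℕ
blockStart lam b = listSum (take (toℕ b) (toList lam))

blockEnd≤sum : ∀ {k} (lam : Vec ℕ k) (b : Fin k) →
  blockStart lam b + lookup lam b ≤ Vec.sum lam
blockEnd≤sum (l ∷ ls) zero    = m≤m+n l _
blockEnd≤sum (l ∷ ls) (suc b) =
  ≤-trans (≤-reflexive (+-assoc l _ _)) (+-monoʳ-≤ l (blockEnd≤sum ls b))

blockEnd≤blockStart : ∀ {k} (lam : Vec ℕ k) {b b′ : Fin k} → toℕ b < toℕ b′ →
  blockStart lam b + lookup lam b ≤ blockStart lam b′
blockEnd≤blockStart (l ∷ ls) {zero}  {suc b′} _     = m≤m+n l _
blockEnd≤blockStart (l ∷ ls) {suc b} {suc b′} b<b′ =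
  ≤-trans (≤-reflexive (+-assoc l _ _)) (+-monoʳ-≤ l (blockEnd≤blockStart ls (s≤s⁻¹ b<b′)))

inBlock-unique : ∀ {k} (lam : Vec ℕ k) {b b′ : Fin k} {i : ℕ} →
  InBlock lam b i → InBlock lam b′ i → b ≡ b′
inBlock-unique lam {b} {b′} (start≤i , i<end) (start′≤i , i<end′) with <-cmp (toℕ b) (toℕ b′)
... | tri< b<b′ _ _ = contradiction (≤-trans (blockEnd≤blockStart lam b<b′) start′≤i) (<⇒≱ i<end)
... | tri≈ _ b≡b′ _ = FinP.toℕ-injective b≡b′
... | tri> _ _ b′<b = contradiction (≤-trans (blockEnd≤blockStart lam b′<b) start≤i) (<⇒≱ i<end′)

blockStart∈block : ∀ {k} (lam : Vec ℕ k) (b : Fin k) → 1 ≤ lookup lam b →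
  InBlock lam b (blockStart lam b)
blockStart∈block lam b 1≤size =
  ≤-refl , subst (_< blockStart lam b + lookup lam b) (+-identityʳ _) (+-monoʳ-< (blockStart lam b) 1≤size)

inUnitBlock⇒≡blockStart : ∀ {k} (lam : Vec ℕ k) {b : Fin k} {i : ℕ} → lookup lam b ≤ 1 →
  InBlock lam b i → i ≡ blockStart lam b
inUnitBlock⇒≡blockStart lam {b} {i} size≤1 (start≤i , i<end) = ≤-antisym i≤start start≤i
  where
  i≤start : i ≤ blockStart lam b
  i≤start = s≤s⁻¹ (≤-trans i<end (≤-trans (+-monoʳ-≤ (blockStart lam b) size≤1)
                                           (≤-reflexive (+-comm (blockStart lam b) 1))))

sameUnitBlock⇒≡ : ∀ {k} (lam : Vec ℕ k) → ((b : Fin k) → lookup lam b ≤ 1) →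
  {i j : ℕ} → SameBlock lam i j → i ≡ j
sameUnitBlock⇒≡ lam units (b , i∈b , j∈b) =
  trans (inUnitBlock⇒≡blockStart lam (units b) i∈b) (sym (inUnitBlock⇒≡blockStart lam (units b) j∈b))

RespectsBlocks : ∀ {p k} {A : Set} → Vec ℕ k → (Fin p → A) → Set
RespectsBlocks {p} lam x = (a a′ : Fin p) → x a ≡ x a′ → SameBlock lam (toℕ a) (toℕ a′)

respectsUnitBlocks⇒injective : ∀ {p k} {A : Set} (lam : Vec ℕ k) {x : Fin p → A} →
  ((b : Fin k) → lookup lam b ≤ 1) → RespectsBlocks lam x → Injective _≡_ _≡_ x
respectsUnitBlocks⇒injective lam units respects {a} {a′} xa≡xa′ =
  FinP.toℕ-injective (sameUnitBlock⇒≡ lam units (respects a a′ xa≡xa′))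

injective∈⇒≤length : ∀ {m} {A : Set} (ys : List A) {g : Fin m → A} →
  Injective _≡_ _≡_ g → (g∈ys : (a : Fin m) → g a ∈ ys) → m ≤ length ys
injective∈⇒≤length ys {g} g-inj g∈ys = FinP.injective⇒≤ index-inj
  where
  index-inj : Injective _≡_ _≡_ (index ∘ g∈ys)
  index-inj {a} {a′} eq = g-inj (trans (lookup-index (g∈ys a))
    (trans (cong (Data.List.lookup ys) eq) (sym (lookup-index (g∈ys a′)))))

≤patternLength : ∀ {p n m} (x : Tuple p n) {f : Fin m → Fin p} →
  Injective _≡_ _≡_ (x ∘ f) → m ≤ patternLength x
≤patternLength x {f} xf-inj = injective∈⇒≤length _ xf-inj
  (λ a → ∈-deduplicate⁺ (VecP.≡-dec FinP._≟_) (∈-toList⁺ (∈-tabulate⁺ x (f a))))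

module _ {p k : ℕ} (lam : Vec ℕ k)
         (positive : (b : Fin k) → 1 ≤ lookup lam b) (sum≡p : Vec.sum lam ≡ p) where

  blockStart<p : (b : Fin k) → blockStart lam b < p
  blockStart<p b = subst (blockStart lam b <_) sum≡p
    (<-≤-trans (proj₂ (blockStart∈block lam b (positive b))) (blockEnd≤sum lam b))

  blockStartFin : Fin k → Fin p
  blockStartFin b = fromℕ< (blockStart<p b)

  toℕ-blockStartFin : (b : Fin k) → toℕ (blockStartFin b) ≡ blockStart lam b
  toℕ-blockStartFin b = FinP.toℕ-fromℕ< (blockStart<p b)

  blockStartFin∈block : (b : Fin k) → InBlock lam b (toℕ (blockStartFin b))
  blockStartFin∈block b =
    subst (InBlock lam b) (sym (toℕ-blockStartFin b)) (blockStart∈block lam b (positive b))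

  withBlockStarts : Fin p → Fin (suc k) → Fin p
  withBlockStarts j zero    = j
  withBlockStarts j (suc b) = blockStartFin b

  module _ {A : Set} {x : Fin p → A} (respects : RespectsBlocks lam x) where

    ≡atBlockStart⇒inBlock : {a : Fin p} {b b′ : Fin k} → InBlock lam b′ (toℕ a) →
      x a ≡ x (blockStartFin b) → b′ ≡ b
    ≡atBlockStart⇒inBlock {a} {b} a∈b′ eq with respects a (blockStartFin b) eq
    ... | β , a∈β , start∈β =
      trans (inBlock-unique lam a∈b′ a∈β) (inBlock-unique lam start∈β (blockStartFin∈block b))

    extraEntry⇒injective : {j : Fin p} (b₀ : Fin k) → InBlock lam b₀ (toℕ j) →
      x j ≢ x (blockStartFin b₀) → Injective _≡_ _≡_ (x ∘ withBlockStarts j)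
    extraEntry⇒injective b₀ j∈b₀ j≢start {zero}  {zero}   _  = refl
    extraEntry⇒injective b₀ j∈b₀ j≢start {zero}  {suc b}  eq =
      ⊥-elim (j≢start (trans eq (cong (x ∘ blockStartFin) (sym (≡atBlockStart⇒inBlock {b = b} j∈b₀ eq)))))
    extraEntry⇒injective b₀ j∈b₀ j≢start {suc b} {zero}   eq =
      sym (extraEntry⇒injective b₀ j∈b₀ j≢start (sym eq))
    extraEntry⇒injective b₀ j∈b₀ j≢start {suc b} {suc b′} eq =
      cong suc (≡atBlockStart⇒inBlock (blockStartFin∈block b) eq)

coveredByDisjoint⇒respectsBlocks : ∀ {p k} {A : Set} {lam : Vec ℕ k} (M : (Fin p → A) → Set) →
  ((c d : Fin p → A) → M c → M d →
    Σ (Fin p) (λ i → Σ (Fin p) (λ j → c i ≡ d j)) → (i : Fin p) → c i ≡ d i) →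
  ((c : Fin p → A) → M c → RespectsBlocks lam c) →
  (x : Fin p → A) → ((i : Fin p) → Σ (Fin p → A) (λ c → M c × c i ≡ x i)) →
  RespectsBlocks lam x
coveredByDisjoint⇒respectsBlocks M disjoint respects x covered a a′ xa≡xa′
  with covered a | covered a′
... | c , Mc , ca≡xa | d , Md , da′≡xa′ = respects c Mc a a′ ca≡ca′
  where
  ca≡da′ : c a ≡ d a′
  ca≡da′ = trans ca≡xa (trans xa≡xa′ (sym da′≡xa′))

  ca≡ca′ : c a ≡ c a′
  ca≡ca′ = trans ca≡da′ (sym (disjoint c d Mc Md (a , a′ , ca≡da′) a′))

shortPattern⇒x₀≡x₁ : ∀ {p n k} (lam : Vec ℕ (suc k)) →
  ((b : Fin (suc k)) → 1 ≤ lookup lam b) → Vec.sum lam ≡ p → 1 < lookup lam zero →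
  {x : Tuple p n} → RespectsBlocks lam x → patternLength x ≤ suc k →
  (i j : Fin p) → toℕ i ≡ 0 → toℕ j ≡ 1 → x i ≡ x j
shortPattern⇒x₀≡x₁ lam positive sum≡p 1<λ₁ {x} respects short i j i≡0 j≡1
  with VecP.≡-dec FinP._≟_ (x i) (x j)
... | yes xi≡xj = xi≡xj
... | no xi≢xj = contradiction short
  (<⇒≱ (≤patternLength x (extraEntry⇒injective lam positive sum≡p respects zero j∈block₀ xj≢start₀)))
  where
  j∈block₀ : InBlock lam zero (toℕ j)
  j∈block₀ = subst (InBlock lam zero) (sym j≡1) (z≤n , 1<λ₁)

  start₀≡i : blockStartFin lam positive sum≡p zero ≡ i
  start₀≡i = FinP.toℕ-injective (trans (toℕ-blockStartFin lam positive sum≡p zero) (sym i≡0))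

  xj≢start₀ : x j ≢ x (blockStartFin lam positive sum≡p zero)
  xj≢start₀ xj≡start₀ = xi≢xj (trans (cong x (sym start₀≡i)) (sym xj≡start₀))

lemma4p2 : (p n : ℕ) → Prime p → 5 ≤ p → 1 ≤ n →
    (A A′ : SubsetF p n) →
    ((x : Tuple p n) → ((i : Fin p) → A (x i)) → Injective _≡_ _≡_ x → ¬ IsCycle x) →
    ((v : Vecp p n) → A′ v → A v) →
    (k : ℕ) → (lam : Vec ℕ k) → IsPattern p k lam →
    ((x : Tuple p n) → ((i : Fin p) → A′ (x i)) → IsCycle x → patternLength x ≤ k) →
    (M : Tuple p n → Set) →
    ((c : Tuple p n) → M c → IsCycle c × ((i : Fin p) → A′ (c i))) →
    ((c d : Tuple p n) → M c → M d →
      Σ (Fin p) (λ i → Σ (Fin p) (λ j → c i ≡ d j)) → (i : Fin p) → c i ≡ d i) →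
    ((c : Tuple p n) → M c → (i j : Fin p) →
      (c i ≡ c j) ⇔ SameBlock lam (toℕ i) (toℕ j)) →
    (x : Tuple p n) →
    ((i : Fin p) → Σ (Tuple p n) (λ c → M c × c i ≡ x i)) →
    IsCycle x →
    (i j : Fin p) → toℕ i ≡ 0 → toℕ j ≡ 1 → x i ≡ x j
lemma4p2 _ _ _ 5≤p _ _ _ _ _ zero [] (_ , _ , sum≡p) _ _ _ _ _ _ _ _ _ _ _ _ =
  contradiction (subst (5 ≤_) (sym sum≡p) 5≤p) λ ()
lemma4p2 p n _ _ _ _ A′ noDistinctCycle A′⊆A (suc k) lam (positive , decreasing , sum≡p)
         boundedLength M M-cycles disjoint blocks x covered x-cycle i =
  shortPattern⇒x₀≡x₁ lam positive sum≡p (≰⇒> λ₁≰1) x-respects (boundedLength x x∈A′ x-cycle) i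
  where
  M-respects : (c : Tuple p n) → M c → RespectsBlocks lam c
  M-respects c c∈M a a′ = Equivalence.to (blocks c c∈M a a′)

  x-respects : RespectsBlocks lam x
  x-respects = coveredByDisjoint⇒respectsBlocks M disjoint M-respects x covered

  x∈A′ : (a : Fin p) → A′ (x a)
  x∈A′ a with covered a
  ... | c , c∈M , ca≡xa = subst A′ ca≡xa (proj₂ (M-cycles c c∈M) a)

  λ₁≰1 : ¬ lookup lam zero ≤ 1
  λ₁≰1 λ₁≤1 with covered i
  ... | c , c∈M , _ = noDistinctCycle c (A′⊆A _ ∘ proj₂ (M-cycles c c∈M))
    (respectsUnitBlocks⇒injective lam (λ b → ≤-trans (decreasing zero b z≤n) λ₁≤1) (M-respects c c∈M))
    (proj₁ (M-cycles c c∈M))
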